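{- Let $G=(V,E)$ be a finite simple graph and write $T\chi^o_G(q)=\sum_\alpha c^o_\alpha(q)M_\alpha$. Then $c^o_\alpha(q)=c^o_{\alpha^{rev}}(q)$ for every composition $\alpha$.
   Context: An orientation $\gamma$ of $G$ directs each edge; it is acyclic if there is no directed cycle. For a proper coloring $\kappa:V\to\mathbb{Z}_{>0}$, $\mathrm{asc}^\gamma(\kappa)$ is the number of edges oriented $u\to v$ with $\kappa(u)<\kappa(v)$; $\chi^\gamma_G(x;q)=\sum_\kappa q^{\mathrm{asc}^\gamma(\kappa)}x^\kappa$ with $x^\kappa=\prod_j x_j^{\#\kappa^{ -1}(j)}$; $T\chi^o_G(q)=\sum_\gamma\chi^\gamma_G(x;q)$ over acyclic orientations. $M_\alpha=\sum_{i_1<\dots<i_\ell}x_{i_1}^{\alpha_1}\cdots x_{i_\ell}^{\alpha_\ell}$; for $\alpha=(\alpha_1,\dots,\alpha_\ell)$, $\alpha^{rev}=(\alpha_\ell,\dots,\alpha_1)$. -}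

module Defs where

open import Data.Bool using (Bool; true; false; _∧_; _∨_; not; _xor_; if_then_else_)
open import Data.Nat using (ℕ; zero; suc; _+_; _≡ᵇ_; _≤_)
open import Data.List.Relation.Unary.All using (All)
open import Data.Fin using (Fin; zero; suc; _<?_) renaming (_≟_ to _≟ᶠ_)
open import Data.List using (List; []; _∷_; [_]; map; concatMap; allFin; length; lookup; upTo)
open import Data.Bool.ListAction using (all; any)
open import Data.Nat.ListAction using (sum)
open import Relation.Nullary.Decidable using (⌊_⌋)
open import Relation.Binary.PropositionalEquality using (_≡_)

record SimpleGraph (n : ℕ) : Set where
  field
    adj    : Fin n → Fin n → Bool
    sym    : ∀ u v → adj u v ≡ adj v u
    irrefl : ∀ v → adj v v ≡ false
open SimpleGraph public

allV : ∀ n → (Fin n → Bool) → Bool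
allV n p = all p (allFin n)

anyV : ∀ n → (Fin n → Bool) → Bool
anyV n p = any p (allFin n)

countL : ∀ {A : Set} → (A → Bool) → List A → ℕ
countL p xs = sum (map (λ a → if p a then 1 else 0) xs)

countV : ∀ n → (Fin n → Bool) → ℕ
countV n p = countL p (allFin n)

-- A candidate orientation: o u v = true means the edge is directed u → v.
Orient : ℕ → Set
Orient n = Fin n → Fin n → Bool

isOrientation : ∀ {n} → SimpleGraph n → Orient n → Bool
isOrientation {n} G o =
  allV n (λ u → allV n (λ v →
    if adj G u v then o u v xor o v u else not (o u v)))

walk : ∀ {n} → Orient n → ℕ → Fin n → Fin n → Bool
walk o zero    u v = ⌊ u ≟ᶠ v ⌋
walk {n} o (suc k) u v = anyV n (λ w → o u w ∧ walk o k w v)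

-- o has a directed cycle iff some vertex lies on a closed directed walk of
-- positive length; it suffices to look at lengths 1..n (a directed cycle
-- has at most n vertices).
isAcyclic : ∀ {n} → Orient n → Bool
isAcyclic {n} o = not (anyV n (λ v → any (λ k → walk o (suc k) v v) (upTo n)))

-- Colorings with colors 1..ℓ are represented as maps into Fin ℓ
-- (Fin index j stands for color j+1).
isProper : ∀ {n ℓ} → SimpleGraph n → (Fin n → Fin ℓ) → Bool
isProper {n} G κ =
  allV n (λ u → allV n (λ v → if adj G u v then not ⌊ κ u ≟ᶠ κ v ⌋ else true))

-- x^κ = x_1^{α_1} ⋯ x_ℓ^{α_ℓ}  (α of length ℓ)
hasType : ∀ {n} (α : List ℕ) → (Fin n → Fin (length α)) → Bool
hasType {n} α κ =
  allV (length α) (λ j → countV n (λ v → ⌊ κ v ≟ᶠ j ⌋) ≡ᵇ lookup α j)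

asc : ∀ {n ℓ} → Orient n → (Fin n → Fin ℓ) → ℕ
asc {n} o κ = sum (map (λ u → countV n (λ v → o u v ∧ ⌊ κ u <? κ v ⌋)) (allFin n))

consF : ∀ {A : Set} {n} → A → (Fin n → A) → Fin (suc n) → A
consF a f zero    = a
consF a f (suc i) = f i

allFuns : ∀ {A : Set} n → List A → List (Fin n → A)
allFuns zero    xs = [ (λ ()) ]
allFuns (suc n) xs = concatMap (λ a → map (consF a) (allFuns n xs)) xs

allBools : List Bool
allBools = true ∷ false ∷ []

allOrient : ∀ n → List (Orient n)
allOrient n = allFuns n (allFuns n allBools)

allColorings : ∀ n ℓ → List (Fin n → Fin ℓ)
allColorings n ℓ = allFuns n (allFin ℓ)

-- Coefficient of q^k x_1^{α_1} ⋯ x_ℓ^{α_ℓ} in Tχ^o_G(q) = Σ_γ χ^γ_G(x;q),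
-- i.e. the coefficient of q^k in c^o_α(q) (the monomial x_1^{α_1}⋯x_ℓ^{α_ℓ}
-- occurs with coefficient 1 in M_α and in no other M_β).
coeffTχo : ∀ {n} → SimpleGraph n → List ℕ → ℕ → ℕ
coeffTχo {n} G α k =
  sum (map (λ o →
         if isOrientation G o ∧ isAcyclic o
         then countL (λ κ → isProper G κ ∧ hasType α κ ∧ (asc o κ ≡ᵇ k))
                     (allColorings n (length α))
         else 0)
       (allOrient n))

isComposition : List ℕ → Set
isComposition α = All (λ a → 1 ≤ a) α

-- Recoloring by j ↦ ℓ+1−j (`opposite`) is a bijection on colorings with colors 1..ℓ; it
-- turns colorings of type α into colorings of type α reversed and ascents along an
-- orientation γ into ascents along the reversed orientation.  Reversing every edge is in turn
-- a bijection on acyclic orientations, so after summing over γ only the reversal of α remains.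
module Submission where

open import Defs
open import Data.Nat using (ℕ)
open import Data.List using (List; reverse)
open import Relation.Binary.PropositionalEquality using (_≡_)

open import Algebra.Bundles using (CommutativeMonoid; CommutativeSemiring)
import Algebra.Properties.CommutativeMonoid.Sum as CommutativeMonoidSum
import Algebra.Properties.Semiring.Sum as SemiringSum
open import Data.Bool using (Bool; true; false; _∧_; _∨_; not; _xor_; if_then_else_)
open import Data.Bool.ListAction using (all; and; any; or)
open import Data.Bool.Properties
  using ( ∧-comm; ∧-assoc; ∨-identityʳ; T-≡
        ; ∨-commutativeMonoid; ∧-commutativeMonoid; ∨-∧-commutativeSemiring)
open import Data.Fin using (Fin; zero; suc; toℕ; opposite; cast; _<_; _<?_)
  renaming (_≟_ to _≟ᶠ_)
import Data.Fin.Permutation as Permutation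
open import Data.Fin.Properties
  using (suc-injective; opposite-prop; opposite-involutive; toℕ<n; toℕ-cast; cast-is-id)
open import Data.List
  using ([]; _∷_; _∷ʳ_; _++_; map; foldr; concatMap; allFin; tabulate; upTo; length; lookup)
open import Data.List.Membership.Propositional.Properties using (∈-allFin)
open import Data.List.Properties
  using (map-tabulate; map-cong; map-∘; map-++; unfold-reverse; length-reverse)
import Data.List.Relation.Unary.All as All
open import Data.List.Relation.Unary.All.Properties using (all⁺)
open import Data.Maybe using (Maybe; just; nothing)
open import Data.Maybe.Properties using (just-injective)
open import Data.Nat using (_+_; _∸_; _≡ᵇ_; s≤s) renaming (_<_ to _<ℕ_)
open import Data.Nat.ListAction using (sum)
open import Data.Nat.ListAction.Properties using (sum-++)
open import Data.Nat.Properties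
  using (+-comm; +-identityʳ; m≤n+m; ∸-monoʳ-<; m∸n+n≡m; +-0-commutativeMonoid)
  renaming (suc-injective to ℕ-suc-injective)
import Data.Vec.Functional.Relation.Binary.Equality.Setoid as VectorEquality
import Data.Vec.Functional.Relation.Binary.Pointwise.Properties as Pointwise
open import Function using (id; _∘_; flip; _⇔_; mk⇔; Equivalence)
open import Level using (0ℓ)
open import Relation.Binary.Bundles using (Setoid)
open import Relation.Binary.Core using (_Preserves_⟶_)
open import Relation.Binary.PropositionalEquality as ≡
  using (refl; trans; cong; cong₂; subst; subst₂; _≗_; module ≡-Reasoning)
import Relation.Binary.Reasoning.Setoid as SetoidReasoning
open import Relation.Nullary.Decidable using (Dec; ⌊_⌋; does-⇔; isYes≗does)

isYes-⇔ : ∀ {A B : Set} → A ⇔ B → (a? : Dec A) (b? : Dec B) → ⌊ a? ⌋ ≡ ⌊ b? ⌋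
isYes-⇔ A⇔B a? b? =
  trans (isYes≗does a?) (trans (does-⇔ A⇔B a? b?) (≡.sym (isYes≗does b?)))

any-cong : ∀ {A : Set} {p q : A → Bool} → p ≗ q → ∀ xs → any p xs ≡ any q xs
any-cong p≗q xs = cong or (map-cong p≗q xs)

all-cong : ∀ {A : Set} {p q : A → Bool} → p ≗ q → ∀ xs → all p xs ≡ all q xs
all-cong p≗q xs = cong and (map-cong p≗q xs)

countL-cong : ∀ {A : Set} {p q : A → Bool} → p ≗ q → ∀ xs → countL p xs ≡ countL q xs
countL-cong p≗q xs = cong sum (map-cong (λ x → cong (if_then 1 else 0) (p≗q x)) xs)

allV-elim : ∀ {n} {p : Fin n → Bool} → allV n p ≡ true → ∀ i → p i ≡ true
allV-elim {n} {p} h i =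
  Equivalence.to T-≡ (All.lookup (all⁺ p (allFin n) (Equivalence.from T-≡ h)) (∈-allFin i))

-- Folds over Fin

module _ (M : CommutativeMonoid 0ℓ 0ℓ) where
  open CommutativeMonoid M using (Carrier; _∙_; ε; _≈_; setoid)
  open CommutativeMonoidSum M using (∑-comm; ∑-permute) renaming (sum to ∑)
  open SetoidReasoning setoid

  fold-allFin : ∀ {n} → (Fin n → Carrier) → Carrier
  fold-allFin {n} f = foldr _∙_ ε (map f (allFin n))

  fold-allFin-∑ : ∀ {n} (f : Fin n → Carrier) → fold-allFin f ≡ ∑ f
  fold-allFin-∑ f = trans (cong (foldr _∙_ ε) (map-tabulate id f)) (foldr-tabulate f)
    where
      foldr-tabulate : ∀ {n} (f : Fin n → Carrier) → foldr _∙_ ε (tabulate f) ≡ ∑ f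
      foldr-tabulate {ℕ.zero}  f = refl
      foldr-tabulate {ℕ.suc n} f = cong (f zero ∙_) (foldr-tabulate (f ∘ suc))

  fold-allFin-opposite : ∀ {n} (f : Fin n → Carrier) →
    fold-allFin f ≈ fold-allFin (f ∘ opposite)
  fold-allFin-opposite f = begin
    fold-allFin f               ≡⟨ fold-allFin-∑ f ⟩
    ∑ f                         ≈⟨ ∑-permute f Permutation.reverse ⟩
    ∑ (f ∘ opposite)            ≡⟨ fold-allFin-∑ (f ∘ opposite) ⟨
    fold-allFin (f ∘ opposite)  ∎

  fold-allFin-comm : ∀ {m n} (f : Fin m → Fin n → Carrier) →
    fold-allFin (λ i → fold-allFin (f i)) ≈ fold-allFin (λ j → fold-allFin (λ i → f i j))
  fold-allFin-comm {m} {n} f = begin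
    fold-allFin (λ i → fold-allFin (f i))
      ≡⟨ cong (foldr _∙_ ε) (map-cong (λ i → fold-allFin-∑ (f i)) (allFin m)) ⟩
    fold-allFin (λ i → ∑ (f i))
      ≡⟨ fold-allFin-∑ (λ i → ∑ (f i)) ⟩
    ∑ (λ i → ∑ (f i))
      ≈⟨ ∑-comm f ⟩
    ∑ (λ j → ∑ (λ i → f i j))
      ≡⟨ fold-allFin-∑ (λ j → ∑ (λ i → f i j)) ⟨
    fold-allFin (λ j → ∑ (λ i → f i j))
      ≡⟨ cong (foldr _∙_ ε) (map-cong (λ j → fold-allFin-∑ (λ i → f i j)) (allFin n)) ⟨
    fold-allFin (λ j → fold-allFin (λ i → f i j))
      ∎

allV-opposite : ∀ {n} (p : Fin n → Bool) → allV n p ≡ allV n (p ∘ opposite)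
allV-opposite = fold-allFin-opposite ∧-commutativeMonoid

sum-allFin-comm : ∀ {m n} (f : Fin m → Fin n → ℕ) →
  sum (map (λ i → sum (map (f i) (allFin n))) (allFin m)) ≡
  sum (map (λ j → sum (map (λ i → f i j) (allFin m))) (allFin n))
sum-allFin-comm = fold-allFin-comm +-0-commutativeMonoid

anyV-comm : ∀ {m n} (f : Fin m → Fin n → Bool) →
  anyV m (λ i → anyV n (f i)) ≡ anyV n (λ j → anyV m (λ i → f i j))
anyV-comm = fold-allFin-comm ∨-commutativeMonoid

module BoolSum = SemiringSum (CommutativeSemiring.semiring ∨-∧-commutativeSemiring)

anyV-∑ : ∀ {n} (p : Fin n → Bool) → anyV n p ≡ BoolSum.sum p
anyV-∑ = fold-allFin-∑ ∨-commutativeMonoid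

∧-distribˡ-anyV : ∀ {n} b (p : Fin n → Bool) → b ∧ anyV n p ≡ anyV n (λ i → b ∧ p i)
∧-distribˡ-anyV b p = trans (cong (b ∧_) (anyV-∑ p))
  (trans (BoolSum.*-distribˡ-sum b p) (≡.sym (anyV-∑ (λ i → b ∧ p i))))

∧-distribʳ-anyV : ∀ {n} b (p : Fin n → Bool) → anyV n p ∧ b ≡ anyV n (λ i → p i ∧ b)
∧-distribʳ-anyV b p = trans (cong (_∧ b) (anyV-∑ p))
  (trans (BoolSum.*-distribʳ-sum b p) (≡.sym (anyV-∑ (λ i → p i ∧ b))))

≟-sym : ∀ {n} (u v : Fin n) → ⌊ u ≟ᶠ v ⌋ ≡ ⌊ v ≟ᶠ u ⌋
≟-sym u v = isYes-⇔ (mk⇔ ≡.sym ≡.sym) (u ≟ᶠ v) (v ≟ᶠ u)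

suc-≟-suc : ∀ {n} (u w : Fin n) → ⌊ suc u ≟ᶠ suc w ⌋ ≡ ⌊ u ≟ᶠ w ⌋
suc-≟-suc u w = isYes-⇔ (mk⇔ suc-injective (cong suc)) (suc u ≟ᶠ suc w) (u ≟ᶠ w)

∑-indicator : ∀ {n} (u : Fin n) (f : Fin n → Bool) →
  BoolSum.sum (λ w → ⌊ u ≟ᶠ w ⌋ ∧ f w) ≡ f u
∑-indicator {ℕ.suc n} zero    f =
  trans (cong (f zero ∨_) (BoolSum.sum-replicate-zero n)) (∨-identityʳ (f zero))
∑-indicator {ℕ.suc n} (suc u) f = trans
  (BoolSum.sum-cong-≗ (λ w → cong (_∧ f (suc w)) (suc-≟-suc u w)))
  (∑-indicator u (f ∘ suc))

anyV-indicator : ∀ {n} (u : Fin n) (f : Fin n → Bool) →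
  anyV n (λ w → ⌊ u ≟ᶠ w ⌋ ∧ f w) ≡ f u
anyV-indicator u f = trans (anyV-∑ (λ w → ⌊ u ≟ᶠ w ⌋ ∧ f w)) (∑-indicator u f)

-- Sums over all functions Fin n → A

-- The functions listed by `allFuns` are equal only pointwise, so a reindexing of a list is
-- described by its effect on sums of weights respecting a setoid equality.
SumInvariant : (S : Setoid 0ℓ 0ℓ) → List (Setoid.Carrier S) →
               (Setoid.Carrier S → Setoid.Carrier S) → Set
SumInvariant S xs σ =
  ∀ (H : Carrier → ℕ) → H Preserves _≈_ ⟶ _≡_ → sum (map H xs) ≡ sum (map (H ∘ σ) xs)
  where open Setoid S

sum-map-concatMap : ∀ {A B : Set} (F : B → ℕ) (g : A → List B) xs →
  sum (map F (concatMap g xs)) ≡ sum (map (λ a → sum (map F (g a))) xs)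
sum-map-concatMap F g []       = refl
sum-map-concatMap F g (x ∷ xs) = begin
  sum (map F (g x ++ concatMap g xs))
    ≡⟨ cong sum (map-++ F (g x) (concatMap g xs)) ⟩
  sum (map F (g x) ++ map F (concatMap g xs))
    ≡⟨ sum-++ (map F (g x)) (map F (concatMap g xs)) ⟩
  sum (map F (g x)) + sum (map F (concatMap g xs))
    ≡⟨ cong (sum (map F (g x)) +_) (sum-map-concatMap F g xs) ⟩
  sum (map F (g x)) + sum (map (λ a → sum (map F (g a))) xs)
    ∎
  where open ≡-Reasoning

sum-map-allFuns-suc : ∀ {A : Set} {n} (F : (Fin (ℕ.suc n) → A) → ℕ) xs →
  sum (map F (allFuns (ℕ.suc n) xs)) ≡
  sum (map (λ a → sum (map (F ∘ consF a) (allFuns n xs))) xs)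
sum-map-allFuns-suc {n = n} F xs = trans
  (sum-map-concatMap F (λ a → map (consF a) (allFuns n xs)) xs)
  (cong sum (map-cong (λ a → cong sum (≡.sym (map-∘ (allFuns n xs)))) xs))

module _ (S : Setoid 0ℓ 0ℓ) where
  open Setoid S using (Carrier; _≈_) renaming (refl to ≈-refl)
  open VectorEquality S using (_≋_; ≋-refl)

  consF-cong : ∀ {n a b} {f g : Fin n → Carrier} → a ≈ b → f ≋ g → consF a f ≋ consF b g
  consF-cong a≈b f≋g zero    = a≈b
  consF-cong a≈b f≋g (suc i) = f≋g i

  allFuns-sumInvariant : ∀ n {xs} (σ : Fin n → Carrier → Carrier) →
    (∀ i → σ i Preserves _≈_ ⟶ _≈_) → (∀ i → SumInvariant S xs (σ i)) →
    SumInvariant (Pointwise.setoid S n) (allFuns n xs) (λ f i → σ i (f i))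
  allFuns-sumInvariant ℕ.zero σ _ _ H H-cong = cong (_+ 0) (H-cong (λ ()))
  allFuns-sumInvariant (ℕ.suc n) {xs} σ σ-cong σ-inv H H-cong = begin
    sum (map H (allFuns (ℕ.suc n) xs))
      ≡⟨ sum-map-allFuns-suc H xs ⟩
    sum (map Hₐ xs)
      ≡⟨ σ-inv zero Hₐ Hₐ-cong ⟩
    sum (map (Hₐ ∘ σ zero) xs)
      ≡⟨ cong sum (map-cong (λ a → allFuns-sumInvariant n (σ ∘ suc) (σ-cong ∘ suc) (σ-inv ∘ suc)
                                     (H ∘ consF (σ zero a)) (H-cong ∘ consF-cong ≈-refl)) xs) ⟩
    sum (map (λ a → sum (map (λ f → H (consF (σ zero a) (σ′ f))) (allFuns n xs))) xs)
      ≡⟨ cong sum (map-cong (λ a → cong sum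
           (map-cong (λ f → H-cong (consF-σ′ a f)) (allFuns n xs))) xs) ⟩
    sum (map (λ a → sum (map (H ∘ σ* ∘ consF a) (allFuns n xs))) xs)
      ≡⟨ sum-map-allFuns-suc (H ∘ σ*) xs ⟨
    sum (map (H ∘ σ*) (allFuns (ℕ.suc n) xs))
      ∎
    where
      open ≡-Reasoning
      σ* : (Fin (ℕ.suc n) → Carrier) → Fin (ℕ.suc n) → Carrier
      σ* f i = σ i (f i)
      σ′ : (Fin n → Carrier) → Fin n → Carrier
      σ′ f i = σ (suc i) (f i)
      consF-σ′ : ∀ a f → consF (σ zero a) (σ′ f) ≋ σ* (consF a f)
      consF-σ′ a f zero    = ≈-refl
      consF-σ′ a f (suc i) = ≈-refl
      Hₐ : Carrier → ℕ
      Hₐ a = sum (map (H ∘ consF a) (allFuns n xs))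
      Hₐ-cong : Hₐ Preserves _≈_ ⟶ _≡_
      Hₐ-cong a≈b = cong sum (map-cong (λ f → H-cong (consF-cong a≈b ≋-refl)) (allFuns n xs))

xor-sumInvariant : ∀ c → SumInvariant (≡.setoid Bool) allBools (_xor c)
xor-sumInvariant true  H _ rewrite +-identityʳ (H true) | +-identityʳ (H false) =
  +-comm (H true) (H false)
xor-sumInvariant false H _ = refl

opposite-sumInvariant : ∀ {ℓ} → SumInvariant (≡.setoid (Fin ℓ)) (allFin ℓ) opposite
opposite-sumInvariant H _ = fold-allFin-opposite +-0-commutativeMonoid H

-- Walks and acyclicity

_≈ᵒ_ : ∀ {n} → Orient n → Orient n → Set
o ≈ᵒ o′ = ∀ u v → o u v ≡ o′ u v

walk-cong : ∀ {n} {o o′ : Orient n} → o ≈ᵒ o′ → ∀ k u v → walk o k u v ≡ walk o′ k u v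
walk-cong o≈o′ ℕ.zero    u v = refl
walk-cong {n} o≈o′ (ℕ.suc k) u v =
  any-cong (λ w → cong₂ _∧_ (o≈o′ u w) (walk-cong o≈o′ k w v)) (allFin n)

isAcyclic-cong : ∀ {n} {o o′ : Orient n} → o ≈ᵒ o′ → isAcyclic o ≡ isAcyclic o′
isAcyclic-cong {n} o≈o′ = cong not
  (any-cong (λ v → any-cong (λ k → walk-cong o≈o′ (ℕ.suc k) v v) (upTo n)) (allFin n))

module _ {n} (o : Orient n) where
  open ≡-Reasoning

  walk-snoc : ∀ k u v → walk o (ℕ.suc k) u v ≡ anyV n (λ w → walk o k u w ∧ o w v)
  walk-snoc ℕ.zero u v = begin
    anyV n (λ w → o u w ∧ ⌊ w ≟ᶠ v ⌋)
      ≡⟨ any-cong (λ w → trans (∧-comm (o u w) _) (cong (_∧ o u w) (≟-sym w v))) (allFin n) ⟩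
    anyV n (λ w → ⌊ v ≟ᶠ w ⌋ ∧ o u w)
      ≡⟨ anyV-indicator v (o u) ⟩
    o u v
      ≡⟨ anyV-indicator u (λ w → o w v) ⟨
    anyV n (λ w → ⌊ u ≟ᶠ w ⌋ ∧ o w v)
      ∎
  walk-snoc (ℕ.suc k) u v = begin
    anyV n (λ w → o u w ∧ walk o (ℕ.suc k) w v)
      ≡⟨ any-cong (λ w → cong (o u w ∧_) (walk-snoc k w v)) (allFin n) ⟩
    anyV n (λ w → o u w ∧ anyV n (λ x → walk o k w x ∧ o x v))
      ≡⟨ any-cong (λ w → ∧-distribˡ-anyV (o u w) (λ x → walk o k w x ∧ o x v)) (allFin n) ⟩
    anyV n (λ w → anyV n (λ x → o u w ∧ (walk o k w x ∧ o x v)))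
      ≡⟨ anyV-comm (λ w x → o u w ∧ (walk o k w x ∧ o x v)) ⟩
    anyV n (λ x → anyV n (λ w → o u w ∧ (walk o k w x ∧ o x v)))
      ≡⟨ any-cong (λ x → any-cong (λ w → ∧-assoc (o u w) _ _) (allFin n)) (allFin n) ⟨
    anyV n (λ x → anyV n (λ w → (o u w ∧ walk o k w x) ∧ o x v))
      ≡⟨ any-cong (λ x → ∧-distribʳ-anyV (o x v) (λ w → o u w ∧ walk o k w x)) (allFin n) ⟨
    anyV n (λ x → walk o (ℕ.suc k) u x ∧ o x v)
      ∎

  walk-flip : ∀ k u v → walk (flip o) k u v ≡ walk o k v u
  walk-flip ℕ.zero    u v = ≟-sym u v
  walk-flip (ℕ.suc k) u v = begin
    anyV n (λ w → o w u ∧ walk (flip o) k w v)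
      ≡⟨ any-cong (λ w → cong (o w u ∧_) (walk-flip k w v)) (allFin n) ⟩
    anyV n (λ w → o w u ∧ walk o k v w)
      ≡⟨ any-cong (λ w → ∧-comm (o w u) _) (allFin n) ⟩
    anyV n (λ w → walk o k v w ∧ o w u)
      ≡⟨ walk-snoc k v u ⟨
    walk o (ℕ.suc k) v u
      ∎

  isAcyclic-flip : isAcyclic (flip o) ≡ isAcyclic o
  isAcyclic-flip = cong not
    (any-cong (λ v → any-cong (λ k → walk-flip (ℕ.suc k) v v) (upTo n)) (allFin n))

-- Orientations

Orientations : ℕ → Setoid 0ℓ 0ℓ
Orientations n = Pointwise.setoid (Pointwise.setoid (≡.setoid Bool) n) n

-- On an orientation of G, toggling every edge of G reverses it (`toggle-orientation`); unlike
-- `flip`, toggling changes each entry o u v on its own, so `allFuns-sumInvariant` applies.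
toggle : ∀ {n} → SimpleGraph n → Orient n → Orient n
toggle G o u v = o u v xor adj G u v

toggle-sumInvariant : ∀ {n} (G : SimpleGraph n) →
  SumInvariant (Orientations n) (allOrient n) (toggle G)
toggle-sumInvariant {n} G =
  allFuns-sumInvariant (Pointwise.setoid (≡.setoid Bool) n) n (λ u r v → r v xor adj G u v)
    (λ u r≋r′ v → cong (_xor adj G u v) (r≋r′ v))
    (λ u → allFuns-sumInvariant (≡.setoid Bool) n (λ v → _xor adj G u v)
             (λ v → cong (_xor adj G u v)) (λ v → xor-sumInvariant (adj G u v)))

isOrientation-cong : ∀ {n} (G : SimpleGraph n) {o o′ : Orient n} → o ≈ᵒ o′ →
  isOrientation G o ≡ isOrientation G o′
isOrientation-cong {n} G o≈o′ = all-cong (λ u → all-cong (λ v →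
  cong₂ (λ a b → if adj G u v then a xor b else not a) (o≈o′ u v) (o≈o′ v u))
  (allFin n)) (allFin n)

isOrientation-toggle : ∀ {n} (G : SimpleGraph n) o →
  isOrientation G (toggle G o) ≡ isOrientation G o
isOrientation-toggle {n} G o = all-cong (λ u → all-cong (λ v → trans
  (cong (λ e → if adj G u v then toggle G o u v xor (o v u xor e) else not (toggle G o u v))
        (SimpleGraph.sym G v u))
  (toggle-entry (adj G u v) (o u v) (o v u))) (allFin n)) (allFin n)
  where
    toggle-entry : ∀ e a b → (if e then (a xor e) xor (b xor e) else not (a xor e)) ≡
                             (if e then a xor b else not a)
    toggle-entry true  true  true  = refl
    toggle-entry true  true  false = refl
    toggle-entry true  false true  = refl
    toggle-entry true  false false = refl
    toggle-entry false true  _     = refl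
    toggle-entry false false _     = refl

toggle-orientation : ∀ {n} (G : SimpleGraph n) {o} → isOrientation G o ≡ true →
  toggle G o ≈ᵒ flip o
toggle-orientation G {o} isOri u v = reversed-entry (adj G u v) (o u v) (o v u) (entry u v)
  (subst (λ e → (if e then o v u xor o u v else not (o v u)) ≡ true)
         (SimpleGraph.sym G v u) (entry v u))
  where
    entry : ∀ u v → (if adj G u v then o u v xor o v u else not (o u v)) ≡ true
    entry u v = allV-elim (allV-elim isOri u) v
    reversed-entry : ∀ e a b → (if e then a xor b else not a) ≡ true →
                     (if e then b xor a else not b) ≡ true → a xor e ≡ b
    reversed-entry true  true  true  () _
    reversed-entry true  true  false _  _ = refl
    reversed-entry true  false true  _  _ = refl
    reversed-entry true  false false () _
    reversed-entry false true  _     () _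
    reversed-entry false false true  _  ()
    reversed-entry false false false _  _ = refl

acyclicOrientationSum : ∀ {n} → SimpleGraph n → (Orient n → ℕ) → ℕ
acyclicOrientationSum {n} G W =
  sum (map (λ o → if isOrientation G o ∧ isAcyclic o then W o else 0) (allOrient n))

acyclicOrientationSum-cong : ∀ {n} (G : SimpleGraph n) {W W′ : Orient n → ℕ} → W ≗ W′ →
  acyclicOrientationSum G W ≡ acyclicOrientationSum G W′
acyclicOrientationSum-cong {n} G W≗W′ = cong sum (map-cong
  (λ o → cong (λ w → if isOrientation G o ∧ isAcyclic o then w else 0) (W≗W′ o)) (allOrient n))

acyclicOrientationSum-flip : ∀ {n} (G : SimpleGraph n) {W : Orient n → ℕ} →
  W Preserves _≈ᵒ_ ⟶ _≡_ → acyclicOrientationSum G (W ∘ flip) ≡ acyclicOrientationSum G W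
acyclicOrientationSum-flip {n} G {W} W-cong = ≡.sym (trans
  (toggle-sumInvariant G summand summand-cong)
  (cong sum (map-cong summand-toggle (allOrient n))))
  where
    summand : Orient n → ℕ
    summand o = if isOrientation G o ∧ isAcyclic o then W o else 0
    summand-cong : summand Preserves _≈ᵒ_ ⟶ _≡_
    summand-cong o≈o′ = cong₂ (λ b w → if b then w else 0)
      (cong₂ _∧_ (isOrientation-cong G o≈o′) (isAcyclic-cong o≈o′)) (W-cong o≈o′)
    summand-toggle : ∀ o → summand (toggle G o) ≡
                           (if isOrientation G o ∧ isAcyclic o then W (flip o) else 0)
    summand-toggle o rewrite isOrientation-toggle G o with isOrientation G o in isOri
    ... | false = refl
    ... | true  = cong₂ (λ b w → if b then w else 0)
      (trans (isAcyclic-cong reversed) (isAcyclic-flip o)) (W-cong reversed)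
      where reversed = toggle-orientation G isOri

-- Colorings

opposite-injective : ∀ {ℓ} {x y : Fin ℓ} → opposite x ≡ opposite y → x ≡ y
opposite-injective {x = x} {y} eq =
  trans (≡.sym (opposite-involutive x)) (trans (cong opposite eq) (opposite-involutive y))

opposite-≟ : ∀ {ℓ} (x y : Fin ℓ) → ⌊ opposite x ≟ᶠ opposite y ⌋ ≡ ⌊ x ≟ᶠ y ⌋
opposite-≟ x y =
  isYes-⇔ (mk⇔ opposite-injective (cong opposite)) (opposite x ≟ᶠ opposite y) (x ≟ᶠ y)

opposite-< : ∀ {ℓ} {x y : Fin ℓ} → x < y → opposite y < opposite x
opposite-< {x = x} {y} x<y = subst₂ _<ℕ_ (≡.sym (opposite-prop y)) (≡.sym (opposite-prop x))
  (∸-monoʳ-< (s≤s x<y) (toℕ<n y))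

opposite-<? : ∀ {ℓ} (x y : Fin ℓ) → ⌊ opposite x <? opposite y ⌋ ≡ ⌊ y <? x ⌋
opposite-<? x y = isYes-⇔ (mk⇔ reflect opposite-<) (opposite x <? opposite y) (y <? x)
  where
    reflect : opposite x < opposite y → y < x
    reflect lt = subst₂ _<_ (opposite-involutive y) (opposite-involutive x) (opposite-< lt)

hasType′ : ∀ {n ℓ} → (Fin ℓ → ℕ) → (Fin n → Fin ℓ) → Bool
hasType′ {n} {ℓ} a κ = allV ℓ (λ j → countV n (λ v → ⌊ κ v ≟ᶠ j ⌋) ≡ᵇ a j)

colorCount : ∀ {n ℓ} → SimpleGraph n → (Fin ℓ → ℕ) → ℕ → Orient n → ℕ
colorCount {n} {ℓ} G a k o =
  countL (λ κ → isProper G κ ∧ hasType′ a κ ∧ (asc o κ ≡ᵇ k)) (allColorings n ℓ)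

isProper-cong : ∀ {n ℓ} (G : SimpleGraph n) {κ κ′ : Fin n → Fin ℓ} → κ ≗ κ′ →
  isProper G κ ≡ isProper G κ′
isProper-cong {n} G κ≗κ′ = all-cong (λ u → all-cong (λ v →
  cong₂ (λ x y → if adj G u v then not ⌊ x ≟ᶠ y ⌋ else true) (κ≗κ′ u) (κ≗κ′ v))
  (allFin n)) (allFin n)

hasType′-cong : ∀ {n ℓ} {a a′ : Fin ℓ → ℕ} {κ κ′ : Fin n → Fin ℓ} → a ≗ a′ → κ ≗ κ′ →
  hasType′ a κ ≡ hasType′ a′ κ′
hasType′-cong {n} {ℓ} a≗a′ κ≗κ′ = all-cong (λ j → cong₂ _≡ᵇ_
  (countL-cong (λ v → cong (λ x → ⌊ x ≟ᶠ j ⌋) (κ≗κ′ v)) (allFin n)) (a≗a′ j)) (allFin ℓ)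

asc-cong : ∀ {n ℓ} {o o′ : Orient n} {κ κ′ : Fin n → Fin ℓ} → o ≈ᵒ o′ → κ ≗ κ′ →
  asc o κ ≡ asc o′ κ′
asc-cong {n} o≈o′ κ≗κ′ = cong sum (map-cong (λ u → countL-cong (λ v →
  cong₂ _∧_ (o≈o′ u v) (cong₂ (λ x y → ⌊ x <? y ⌋) (κ≗κ′ u) (κ≗κ′ v))) (allFin n)) (allFin n))

colorCount-cong : ∀ {n ℓ} (G : SimpleGraph n) {a a′ : Fin ℓ → ℕ} k {o o′ : Orient n} →
  a ≗ a′ → o ≈ᵒ o′ → colorCount G a k o ≡ colorCount G a′ k o′
colorCount-cong {n} {ℓ} G k a≗a′ o≈o′ = countL-cong (λ κ → cong (isProper G κ ∧_)
  (cong₂ _∧_ (hasType′-cong {κ = κ} a≗a′ (λ _ → refl))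
             (cong (_≡ᵇ k) (asc-cong {κ = κ} o≈o′ (λ _ → refl)))))
  (allColorings n ℓ)

isProper-opposite : ∀ {n ℓ} (G : SimpleGraph n) (κ : Fin n → Fin ℓ) →
  isProper G (opposite ∘ κ) ≡ isProper G κ
isProper-opposite {n} G κ = all-cong (λ u → all-cong (λ v →
  cong (λ b → if adj G u v then not b else true) (opposite-≟ (κ u) (κ v)))
  (allFin n)) (allFin n)

hasType′-opposite : ∀ {n ℓ} (a : Fin ℓ → ℕ) (κ : Fin n → Fin ℓ) →
  hasType′ a (opposite ∘ κ) ≡ hasType′ (a ∘ opposite) κ
hasType′-opposite {n} {ℓ} a κ = trans
  (allV-opposite (λ j → countV n (λ v → ⌊ opposite (κ v) ≟ᶠ j ⌋) ≡ᵇ a j))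
  (all-cong (λ j → cong (_≡ᵇ a (opposite j))
    (countL-cong (λ v → opposite-≟ (κ v) j) (allFin n))) (allFin ℓ))

asc-opposite : ∀ {n ℓ} (o : Orient n) (κ : Fin n → Fin ℓ) →
  asc o (opposite ∘ κ) ≡ asc (flip o) κ
asc-opposite {n} o κ = trans
  (cong sum (map-cong (λ u → countL-cong (λ v → cong (o u v ∧_) (opposite-<? (κ u) (κ v)))
    (allFin n)) (allFin n)))
  (sum-allFin-comm (λ u v → if o u v ∧ ⌊ κ v <? κ u ⌋ then 1 else 0))

colorCount-opposite : ∀ {n ℓ} (G : SimpleGraph n) (a : Fin ℓ → ℕ) k o →
  colorCount G a k o ≡ colorCount G (a ∘ opposite) k (flip o)
colorCount-opposite {n} {ℓ} G a k o = trans
  (allFuns-sumInvariant (≡.setoid (Fin ℓ)) n (λ _ → opposite) (λ _ → cong opposite)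
     (λ _ → opposite-sumInvariant) summand summand-cong)
  (countL-cong (λ κ → cong₂ _∧_ (isProper-opposite G κ)
     (cong₂ _∧_ (hasType′-opposite a κ) (cong (_≡ᵇ k) (asc-opposite o κ))))
     (allColorings n ℓ))
  where
    summand : (Fin n → Fin ℓ) → ℕ
    summand κ = if isProper G κ ∧ hasType′ a κ ∧ (asc o κ ≡ᵇ k) then 1 else 0
    summand-cong : ∀ {κ κ′} → κ ≗ κ′ → summand κ ≡ summand κ′
    summand-cong κ≗κ′ = cong (if_then 1 else 0) (cong₂ _∧_ (isProper-cong G κ≗κ′)
      (cong₂ _∧_ (hasType′-cong (λ _ → refl) κ≗κ′)
                 (cong (_≡ᵇ k) (asc-cong (λ _ _ → refl) κ≗κ′))))

colorCount-cast : ∀ {n ℓ ℓ′} (G : SimpleGraph n) (e : ℓ′ ≡ ℓ) (a : Fin ℓ → ℕ) k o →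
  colorCount G (a ∘ cast e) k o ≡ colorCount G a k o
colorCount-cast G refl a k o =
  colorCount-cong G k (λ j → cong a (cast-is-id refl j)) (λ _ _ → refl)

-- Reversal of lists

lookupMaybe : ∀ {A : Set} → List A → ℕ → Maybe A
lookupMaybe []       _         = nothing
lookupMaybe (x ∷ xs) ℕ.zero    = just x
lookupMaybe (x ∷ xs) (ℕ.suc i) = lookupMaybe xs i

lookupMaybe-toℕ : ∀ {A : Set} (xs : List A) i → lookupMaybe xs (toℕ i) ≡ just (lookup xs i)
lookupMaybe-toℕ (x ∷ xs) zero    = refl
lookupMaybe-toℕ (x ∷ xs) (suc i) = lookupMaybe-toℕ xs i

lookupMaybe-∷ʳ-< : ∀ {A : Set} (xs : List A) y {i} → i <ℕ length xs →
  lookupMaybe (xs ∷ʳ y) i ≡ lookupMaybe xs i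
lookupMaybe-∷ʳ-< (x ∷ xs) y {ℕ.zero}  _         = refl
lookupMaybe-∷ʳ-< (x ∷ xs) y {ℕ.suc i} (s≤s i<n) = lookupMaybe-∷ʳ-< xs y i<n

lookupMaybe-∷ʳ-length : ∀ {A : Set} (xs : List A) y →
  lookupMaybe (xs ∷ʳ y) (length xs) ≡ just y
lookupMaybe-∷ʳ-length []       y = refl
lookupMaybe-∷ʳ-length (x ∷ xs) y = lookupMaybe-∷ʳ-length xs y

lookupMaybe-reverse : ∀ {A : Set} (xs : List A) {i} j → j + ℕ.suc i ≡ length xs →
  lookupMaybe (reverse xs) i ≡ lookupMaybe xs j
lookupMaybe-reverse (x ∷ xs) ℕ.zero refl = begin
  lookupMaybe (reverse (x ∷ xs)) (length xs)
    ≡⟨ cong (λ ys → lookupMaybe ys (length xs)) (unfold-reverse x xs) ⟩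
  lookupMaybe (reverse xs ∷ʳ x) (length xs)
    ≡⟨ cong (lookupMaybe (reverse xs ∷ʳ x)) (length-reverse xs) ⟨
  lookupMaybe (reverse xs ∷ʳ x) (length (reverse xs))
    ≡⟨ lookupMaybe-∷ʳ-length (reverse xs) x ⟩
  just x
    ∎
  where open ≡-Reasoning
lookupMaybe-reverse (x ∷ xs) {i} (ℕ.suc j) eq = begin
  lookupMaybe (reverse (x ∷ xs)) i  ≡⟨ cong (λ ys → lookupMaybe ys i) (unfold-reverse x xs) ⟩
  lookupMaybe (reverse xs ∷ʳ x) i   ≡⟨ lookupMaybe-∷ʳ-< (reverse xs) x i<n ⟩
  lookupMaybe (reverse xs) i        ≡⟨ lookupMaybe-reverse xs j eq′ ⟩
  lookupMaybe xs j                  ∎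
  where
    open ≡-Reasoning
    eq′ : j + ℕ.suc i ≡ length xs
    eq′ = ℕ-suc-injective eq
    i<n : i <ℕ length (reverse xs)
    i<n = subst (i <ℕ_) (trans eq′ (≡.sym (length-reverse xs))) (m≤n+m (ℕ.suc i) j)

lookup-reverse : ∀ {A : Set} (xs : List A) i →
  lookup (reverse xs) i ≡ lookup xs (opposite (cast (length-reverse xs) i))
lookup-reverse xs i = just-injective (begin
  just (lookup (reverse xs) i)      ≡⟨ lookupMaybe-toℕ (reverse xs) i ⟨
  lookupMaybe (reverse xs) (toℕ i)  ≡⟨ lookupMaybe-reverse xs (toℕ j) positions ⟩
  lookupMaybe xs (toℕ j)            ≡⟨ lookupMaybe-toℕ xs j ⟩
  just (lookup xs j)                ∎)
  where
    open ≡-Reasoning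
    i′ = cast (length-reverse xs) i
    j = opposite i′
    positions : toℕ j + ℕ.suc (toℕ i) ≡ length xs
    positions = begin
      toℕ j + ℕ.suc (toℕ i)
        ≡⟨ cong₂ _+_ (opposite-prop i′) (cong ℕ.suc (≡.sym (toℕ-cast _ i))) ⟩
      (length xs ∸ ℕ.suc (toℕ i′)) + ℕ.suc (toℕ i′)
        ≡⟨ m∸n+n≡m (toℕ<n i′) ⟩
      length xs
        ∎

colorCount-reverse : ∀ {n} (G : SimpleGraph n) (α : List ℕ) k o →
  colorCount G (lookup (reverse α)) k o ≡ colorCount G (lookup α ∘ opposite) k o
colorCount-reverse G α k o = trans
  (colorCount-cong G k (lookup-reverse α) (λ _ _ → refl))
  (colorCount-cast G (length-reverse α) (lookup α ∘ opposite) k o)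

theorem3p11 : ∀ {n} (G : SimpleGraph n) (α : List ℕ) → isComposition α →
                  ∀ (k : ℕ) → coeffTχo G α k ≡ coeffTχo G (reverse α) k
theorem3p11 G α _ k = begin
  coeffTχo G α k
    ≡⟨⟩
  acyclicOrientationSum G (colorCount G (lookup α) k)
    ≡⟨ acyclicOrientationSum-cong G (colorCount-opposite G (lookup α) k) ⟩
  acyclicOrientationSum G (colorCount G (lookup α ∘ opposite) k ∘ flip)
    ≡⟨ acyclicOrientationSum-flip G (colorCount-cong G k (λ _ → refl)) ⟩
  acyclicOrientationSum G (colorCount G (lookup α ∘ opposite) k)
    ≡⟨ acyclicOrientationSum-cong G (colorCount-reverse G α k) ⟨
  acyclicOrientationSum G (colorCount G (lookup (reverse α)) k)
    ≡⟨⟩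
  coeffTχo G (reverse α) k
    ∎
  where open ≡-Reasoning
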